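{- Let $G$ and $H$ be rooted digraphs and let $\phi$ be a robust map from $G$ to $H$. If Angel wins the Angel-Devil game on $H$, then Angel wins the Angel-Devil game on $G$.
   Context: A rooted digraph is a digraph (loops allowed) with a designated root vertex. If $G,H$ have roots $g_0,h_0$, a robust map from $G$ to $H$ is a map $\phi:V(G)\to V(H)$ with $\phi(g_0)=h_0$ such that whenever $\phi(v)\to w$ is an edge of $H$, there is a vertex $z$ of $G$ with $\phi(z)=w$ and $v\to z$ an edge of $G$. The Angel-Devil game on a rooted digraph: vertices start unburned; Angel starts at the root; players alternate, Angel first; Angel moves from his current vertex to an unburned out-neighbor, and Devil burns at most one vertex per turn (permanently). Devil wins if Angel is ever unable to move; Angel wins if he has a strategy to move forever. -}

module Defs where

open import Data.List using (List; []; _∷_)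
open import Data.List.Membership.Propositional using (_∈_)
open import Data.Maybe using (Maybe; just; nothing)
open import Data.Product using (Σ; _×_; _,_)
open import Relation.Nullary using (¬_)
open import Relation.Binary.PropositionalEquality using (_≡_)

record RootedDigraph : Set₁ where
  field
    V    : Set
    _⇒_  : V → V → Set
    root : V
open RootedDigraph public

record RobustMap (G H : RootedDigraph) : Set where
  field
    φ       : V G → V H
    φ-root  : φ (root G) ≡ root H
    φ-lift  : ∀ (v : V G) (w : V H) → _⇒_ H (φ v) w →
              Σ (V G) λ z → (φ z ≡ w) × _⇒_ G v z
open RobustMap public

-- A Devil move: burn at most one vertex (nothing = burn nothing).
-- A Devil history is the list of Devil moves made so far, most recent first.
DevilHistory : RootedDigraph → Set
DevilHistory G = List (Maybe (V G))

burned : {A : Set} → List (Maybe A) → List A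
burned []             = []
burned (nothing ∷ ds) = burned ds
burned (just x  ∷ ds) = x ∷ burned ds

-- An Angel strategy: given the full history of Devil's moves so far (Angel's
-- own earlier moves are determined by the strategy and that history), the
-- vertex Angel moves to next.
AngelStrategy : RootedDigraph → Set
AngelStrategy G = DevilHistory G → V G

position : (G : RootedDigraph) → AngelStrategy G → DevilHistory G → V G
position G σ []       = root G
position G σ (d ∷ ds) = σ ds

-- σ is winning: against every sequence of Devil moves, each move prescribed
-- by σ is legal (to an unburned out-neighbour of Angel's current vertex),
-- so Angel moves forever.
Winning : (G : RootedDigraph) → AngelStrategy G → Set
Winning G σ = ∀ (ds : DevilHistory G) →
  _⇒_ G (position G σ ds) (σ ds) × ¬ (σ ds ∈ burned ds)

AngelWins : RootedDigraph → Set
AngelWins G = Σ (AngelStrategy G) (Winning G)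

module Submission where

-- Angel plays on G by shadowing a winning strategy on H through φ: Devil's
-- burns are pushed forward along φ, and each move prescribed on H is lifted
-- along an edge of G by robustness, keeping φ (Angel's vertex in G) equal to
-- Angel's vertex in H.  A burned lift would have a burned image in H, which
-- the winning strategy on H never visits.

open import Data.List using (List; []; _∷_; map)
open import Data.List.Membership.Propositional using (_∈_)
open import Data.List.Relation.Unary.Any using (here; there)
open import Data.Maybe using (Maybe; just; nothing)
import Data.Maybe as Maybe
open import Data.Product using (Σ; _×_; _,_; proj₁; proj₂)
open import Function using (_∘_)
open import Relation.Nullary using (¬_)
open import Relation.Binary.PropositionalEquality using (_≡_; refl; sym; subst)

open import Defs

∈-burned-map : {A B : Set} (f : A → B) {x : A} (ds : List (Maybe A)) →
               x ∈ burned ds → f x ∈ burned (map (Maybe.map f) ds)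
∈-burned-map f (nothing ∷ ds) x∈ds         = ∈-burned-map f ds x∈ds
∈-burned-map f (just _ ∷ ds)  (here refl)  = here refl
∈-burned-map f (just _ ∷ ds)  (there x∈ds) = there (∈-burned-map f ds x∈ds)

module RobustLift {G H : RootedDigraph} (ρ : RobustMap G H)
                  (σ : AngelStrategy H) (σ-wins : Winning H σ) where

  image : DevilHistory G → DevilHistory H
  image = map (Maybe.map (φ ρ))

  mutual
    liftedPosition : DevilHistory G → V G
    liftedPosition []       = root G
    liftedPosition (_ ∷ ds) = proj₁ (liftedMove ds)

    φ-liftedPosition : ∀ ds → φ ρ (liftedPosition ds) ≡ position H σ (image ds)
    φ-liftedPosition []       = φ-root ρ
    φ-liftedPosition (_ ∷ ds) = proj₁ (proj₂ (liftedMove ds))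

    liftedMove : ∀ ds → Σ (V G) λ z → (φ ρ z ≡ σ (image ds)) × _⇒_ G (liftedPosition ds) z
    liftedMove ds = φ-lift ρ (liftedPosition ds) (σ (image ds))
      (subst (λ v → _⇒_ H v (σ (image ds))) (sym (φ-liftedPosition ds))
             (proj₁ (σ-wins (image ds))))

  lifted : AngelStrategy G
  lifted = proj₁ ∘ liftedMove

  position-lifted : ∀ ds → position G lifted ds ≡ liftedPosition ds
  position-lifted []      = refl
  position-lifted (_ ∷ _) = refl

  lifted-wins : Winning G lifted
  lifted-wins ds = legal , unburned
    where
    legal : _⇒_ G (position G lifted ds) (lifted ds)
    legal = subst (λ v → _⇒_ G v (lifted ds)) (sym (position-lifted ds))
                  (proj₂ (proj₂ (liftedMove ds)))

    unburned : ¬ (lifted ds ∈ burned ds)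
    unburned b = proj₂ (σ-wins (image ds))
      (subst (_∈ burned (image ds)) (proj₁ (proj₂ (liftedMove ds)))
             (∈-burned-map (φ ρ) ds b))

theorem9 : (G H : RootedDigraph) → RobustMap G H → AngelWins H → AngelWins G
theorem9 G H ρ (σ , σ-wins) = lifted , lifted-wins
  where open RobustLift ρ σ σ-wins
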